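{- Fix $\ell\ge 1$ and $\ell$-tuples of non-negative integers $\vec\alpha=(\alpha_0,\dots,\alpha_{\ell-1})$, $\vec\beta=(\beta_0,\dots,\beta_{\ell-1})$. The infinite lower-triangular array whose $(n,m)$-entry is $M^\ell_{n,m}(\vec\alpha,\vec\beta)$ ($n,m\ge 0$) is a proper Riordan array with $A$-sequence $$A(t)=1+\beta_0t+\beta_1t^2+\dots+\beta_{\ell-1}t^\ell+t^{\ell+1}$$ and $Z$-sequence $$Z(t)=\alpha_0+\alpha_1t+\dots+\alpha_{\ell-1}t^{\ell-1}+t^\ell.$$
   Context: An order-$\ell$ Motzkin path of length $n$ and height $m$ is an integer lattice path from $(0,0)$ to $(n,m)$ using steps $U=(1,1)$ and $D_i=(1,-i)$ for $0\le i\le \ell$, never going below $y=0$. For $\ell$-tuples of non-negative integers $\vec\alpha,\vec\beta$, an $(\vec\alpha,\vec\beta)$-colored Motzkin path is such a path in which, for each $0\le i\le \ell-1$, each $D_i$ step whose right endpoint is at height $0$ is labeled by one of $\alpha_i$ colors and each $D_i$ step whose right endpoint is at height $>0$ is labeled by one of $\beta_i$ colors; $U$ and $D_\ell$ steps are unlabeled. $M^\ell_{n,m}(\vec\alpha,\vec\beta)$ is the number of such colored paths of length $n$ and height $m$. A proper Riordan array $\mathcal R(d(t),h(t))$, for formal power series with $d(0)\ne0$, $h(0)=0$, $h'(0)\neq 0$, is the lower-triangular array with $(i,j)$-entry $d_{i,j}=[t^i]\,d(t)h(t)^j$. Power series $A(t)=\sum a_rt^r$ and $Z(t)=\sum z_rt^r$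 are its $A$-sequence and $Z$-sequence if for all $i\ge1$: $d_{i,j}=\sum_{r\ge0}a_r d_{i-1,j-1+r}$ for $j\ge1$ and $d_{i,0}=\sum_{r\ge0} z_r d_{i-1,r}$. -}

module Defs where

open import Data.Nat as ℕ using (ℕ; zero; suc; _<?_; _≟_)
open import Data.Fin using (Fin; toℕ; fromℕ<)
open import Data.Integer as ℤ using (ℤ; +_; 0ℤ; 1ℤ)
open import Data.Product using (Σ; _×_; _,_)
open import Relation.Nullary using (¬_; yes; no)
open import Relation.Binary.PropositionalEquality using (_≡_)

-- Path ℓ α β n m : the (α,β)-colored order-ℓ Motzkin paths from (0,0)
-- to (n,m).  A path is built step by step (snoc-style); heights are
-- natural numbers, so the path never goes below y = 0.
--   up   : a U = (1,1) step
--   down : a D_i = (1,-i) step with i < ℓ, ending at height h, labeled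
--          by one of α_i colors if h = 0 and one of β_i colors if h > 0
--   downℓ: an (unlabeled) D_ℓ = (1,-ℓ) step

colors : {ℓ : ℕ} (α β : Fin ℓ → ℕ) → Fin ℓ → ℕ → ℕ
colors α β i zero    = α i
colors α β i (suc _) = β i

data Path (ℓ : ℕ) (α β : Fin ℓ → ℕ) : ℕ → ℕ → Set where
  nil   : Path ℓ α β 0 0
  up    : ∀ {n h} → Path ℓ α β n h → Path ℓ α β (suc n) (suc h)
  down  : ∀ {n h} (i : Fin ℓ) → Path ℓ α β n (h ℕ.+ toℕ i)
        → Fin (colors α β i h) → Path ℓ α β (suc n) h
  downℓ : ∀ {n h} → Path ℓ α β n (h ℕ.+ ℓ) → Path ℓ α β (suc n) h

FPS : Set
FPS = ℕ → ℤ

sumTo : ℕ → (ℕ → ℤ) → ℤ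
sumTo zero    f = f 0
sumTo (suc n) f = sumTo n f ℤ.+ f (suc n)

oneS : FPS
oneS zero    = 1ℤ
oneS (suc _) = 0ℤ

_⊛_ : FPS → FPS → FPS
(f ⊛ g) n = sumTo n (λ k → f k ℤ.* g (n ℕ.∸ k))

_^S_ : FPS → ℕ → FPS
f ^S zero  = oneS
f ^S suc j = (f ^S j) ⊛ f

IsProper : FPS → FPS → Set
IsProper d h = (¬ d 0 ≡ 0ℤ) × (h 0 ≡ 0ℤ) × (¬ h 1 ≡ 0ℤ)

riordanEntry : FPS → FPS → ℕ → ℕ → ℤ
riordanEntry d h i j = ((d ⊛ (h ^S j))) i

IsProperRiordan : (ℕ → ℕ → ℤ) → Set
IsProperRiordan D =
  Σ FPS λ d → Σ FPS λ h → IsProper d h × (∀ i j → D i j ≡ riordanEntry d h i j)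

-- A-sequence: d_{i,j} = Σ_r a_r d_{i-1,j-1+r}  for i ≥ 1, j ≥ 1.
-- (Written with i ↦ suc i, j ↦ suc j; the sum is truncated at r = i, since
-- for a lower-triangular array d_{i,j+r} = 0 once j + r > i.)
IsASequence : (ℕ → ℕ → ℤ) → FPS → Set
IsASequence D a = ∀ i j → D (suc i) (suc j) ≡ sumTo i (λ r → a r ℤ.* D i (j ℕ.+ r))

-- Z-sequence: d_{i,0} = Σ_r z_r d_{i-1,r}  for i ≥ 1 (same truncation).
IsZSequence : (ℕ → ℕ → ℤ) → FPS → Set
IsZSequence D z = ∀ i → D (suc i) 0 ≡ sumTo i (λ r → z r ℤ.* D i r)

Aseq : (ℓ : ℕ) → (Fin ℓ → ℕ) → FPS
Aseq ℓ β zero = 1ℤ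
Aseq ℓ β (suc r) with r <? ℓ
... | yes p = + β (fromℕ< p)
... | no _ with r ≟ ℓ
...   | yes _ = 1ℤ
...   | no _  = 0ℤ

Zseq : (ℓ : ℕ) → (Fin ℓ → ℕ) → FPS
Zseq ℓ α r with r <? ℓ
... | yes p = + α (fromℕ< p)
... | no _ with r ≟ ℓ
...   | yes _ = 1ℤ
...   | no _  = 0ℤ

-- An array whose row 0 is (d₀, 0, 0, …) and which satisfies an A-sequence
-- recurrence with a₀ ≠ 0 is the proper Riordan array R(d, h), where d is its
-- column 0 and h is column 1 of R(1, h), the array with the same A-sequence
-- and column 0 equal to 1; this follows from the convolution identity
-- X_{i,j+k} = Σ_m X_{m,j} H_{i−m,k}.  Decomposing
-- a colored Motzkin path by its last step gives M_{n+1,h+1} = M_{n,h} +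
-- Σ_i β_i M_{n,h+1+i} + M_{n,h+1+ℓ} and M_{n+1,0} = Σ_i α_i M_{n,i} + M_{n,ℓ},
-- which are exactly the A- and Z-sequence recurrences, since M is lower
-- triangular.
module Submission where

open import Defs
open import Data.Nat using (ℕ; _≤_)
open import Data.Fin using (Fin)
open import Data.Integer using (+_)
open import Function.Bundles using (_↔_)
open import Data.Product using (_×_)

open import Data.Nat as ℕ using (zero; suc; z≤n; s≤s; _<_; _∸_)
open import Data.Nat.Properties
  using (≤-refl; <-≤-trans; <-trans; n≮n; m≤n⇒m≤1+n; m≤m+n; m≤n+m; m+n≤o⇒m≤o;
         m≤n⇒m<n∨m≡n; <⇒≱; +-suc; +-assoc; +-comm; +-identityʳ; n∸n≡0; m∸n≤m; +-∸-assoc;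
         +-0-monoid)
open import Data.Integer as ℤ using (ℤ; 0ℤ; 1ℤ; _+_; _*_)
import Data.Integer.Properties as ℤ
open import Algebra.Properties.CommutativeSemigroup ℤ.+-commutativeSemigroup
  using (interchange)
open import Algebra.Properties.CommutativeSemigroup ℤ.*-commutativeSemigroup
  using (x∙yz≈y∙xz)
open import Algebra.Properties.Monoid.Sum +-0-monoid
  using () renaming (sum to sumℕ)
open import Algebra.Properties.Monoid.Sum ℤ.+-0-monoid
  using (sum-cong-≗) renaming (sum to sumℤ)
open import Data.Fin as Fin using (toℕ)
open import Data.Fin.Properties using (toℕ<n; fromℕ<-toℕ; +↔⊎; *↔×)
open import Data.Fin.Permutation using (↔⇒≡)
open import Data.Product using (Σ; _,_)
open import Data.Sum using (_⊎_; inj₁; inj₂)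
open import Relation.Nullary using (¬_; yes; no; contradiction)
open import Relation.Binary.PropositionalEquality
open import Function.Bundles using (mk↔ₛ′; Inverse)
open import Function.Construct.Composition using (_↔-∘_)
open import Function.Construct.Symmetry using (↔-sym)
open import Function.Construct.Identity using (↔-id)
open import Data.Sum.Function.Propositional using (_⊎-↔_)
open import Data.Product.Function.NonDependent.Propositional using (_×-↔_)

open ≡-Reasoning

sumTo-cong : ∀ n {f g : ℕ → ℤ} → (∀ r → r ≤ n → f r ≡ g r) → sumTo n f ≡ sumTo n g
sumTo-cong zero    f≗g = f≗g 0 z≤n
sumTo-cong (suc n) f≗g =
  cong₂ _+_ (sumTo-cong n (λ r r≤n → f≗g r (m≤n⇒m≤1+n r≤n))) (f≗g (suc n) ≤-refl)

sumTo-zero : ∀ n {f : ℕ → ℤ} → (∀ r → r ≤ n → f r ≡ 0ℤ) → sumTo n f ≡ 0ℤ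
sumTo-zero zero    f≗0 = f≗0 0 z≤n
sumTo-zero (suc n) f≗0 =
  cong₂ _+_ (sumTo-zero n (λ r r≤n → f≗0 r (m≤n⇒m≤1+n r≤n))) (f≗0 (suc n) ≤-refl)

sumTo-+ : ∀ n (f g : ℕ → ℤ) → sumTo n (λ r → f r + g r) ≡ sumTo n f + sumTo n g
sumTo-+ zero    f g = refl
sumTo-+ (suc n) f g =
  trans (cong (_+ (f (suc n) + g (suc n))) (sumTo-+ n f g))
        (interchange (sumTo n f) (sumTo n g) (f (suc n)) (g (suc n)))

sumTo-distribˡ : ∀ n c (f : ℕ → ℤ) → c * sumTo n f ≡ sumTo n (λ r → c * f r)
sumTo-distribˡ zero    c f = refl
sumTo-distribˡ (suc n) c f =
  trans (ℤ.*-distribˡ-+ c (sumTo n f) (f (suc n)))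
        (cong (_+ (c * f (suc n))) (sumTo-distribˡ n c f))

sumTo-comm : ∀ n m (f : ℕ → ℕ → ℤ) →
  sumTo n (λ r → sumTo m (f r)) ≡ sumTo m (λ s → sumTo n (λ r → f r s))
sumTo-comm zero    m f = refl
sumTo-comm (suc n) m f =
  trans (cong (_+ sumTo m (f (suc n))) (sumTo-comm n m f))
        (sym (sumTo-+ m (λ s → sumTo n (λ r → f r s)) (f (suc n))))

sumTo-suc : ∀ n (f : ℕ → ℤ) → sumTo (suc n) f ≡ f 0 + sumTo n (λ r → f (suc r))
sumTo-suc zero    f = refl
sumTo-suc (suc n) f =
  trans (cong (_+ f (suc (suc n))) (sumTo-suc n f)) (ℤ.+-assoc (f 0) _ _)

sumTo-truncate : ∀ {n} m (f : ℕ → ℤ) → n ≤ m →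
  (∀ r → n < r → r ≤ m → f r ≡ 0ℤ) → sumTo m f ≡ sumTo n f
sumTo-truncate zero    f z≤n tail≗0 = refl
sumTo-truncate {n} (suc m) f n≤1+m tail≗0 with m≤n⇒m<n∨m≡n n≤1+m
... | inj₂ refl = refl
... | inj₁ (s≤s n≤m) = begin
  sumTo m f + f (suc m) ≡⟨ cong₂ _+_ (sumTo-truncate m f n≤m (λ r n<r r≤m → tail≗0 r n<r (m≤n⇒m≤1+n r≤m)))
                                     (tail≗0 (suc m) (s≤s n≤m) ≤-refl) ⟩
  sumTo n f + 0ℤ        ≡⟨ ℤ.+-identityʳ (sumTo n f) ⟩
  sumTo n f             ∎

sumTo-toℕ : ∀ n (f : ℕ → ℤ) → sumTo n f ≡ sumℤ {n} (λ k → f (toℕ k)) + f n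
sumTo-toℕ zero    f = sym (ℤ.+-identityˡ (f 0))
sumTo-toℕ (suc n) f = begin
  sumTo (suc n) f                                            ≡⟨ sumTo-suc n f ⟩
  f 0 + sumTo n (λ r → f (suc r))                            ≡⟨ cong (λ t → f 0 + t) (sumTo-toℕ n (λ r → f (suc r))) ⟩
  f 0 + (sumℤ {n} (λ k → f (suc (toℕ k))) + f (suc n))        ≡⟨ ℤ.+-assoc (f 0) _ _ ⟨
  sumℤ {suc n} (λ k → f (toℕ k)) + f (suc n)                 ∎

pos-sumℕ : ∀ {n} (f : Fin n → ℕ) (g : Fin n → ℤ) → (∀ k → + f k ≡ g k) → + sumℕ f ≡ sumℤ g
pos-sumℕ {zero}  f g f≗g = refl
pos-sumℕ {suc n} f g f≗g =
  trans (ℤ.pos-+ (f Fin.zero) _)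
        (cong₂ _+_ (f≗g Fin.zero) (pos-sumℕ (λ k → f (Fin.suc k)) (λ k → g (Fin.suc k)) (λ k → f≗g (Fin.suc k))))

sumTo-interchange : ∀ n m (a x : ℕ → ℤ) (g : ℕ → ℕ → ℤ) →
  sumTo n (λ r → a r * sumTo m (λ s → x s * g s r))
    ≡ sumTo m (λ s → x s * sumTo n (λ r → a r * g s r))
sumTo-interchange n m a x g = begin
  sumTo n (λ r → a r * sumTo m (λ s → x s * g s r))
    ≡⟨ sumTo-cong n (λ r _ → sumTo-distribˡ m (a r) _) ⟩
  sumTo n (λ r → sumTo m (λ s → a r * (x s * g s r)))
    ≡⟨ sumTo-comm n m _ ⟩
  sumTo m (λ s → sumTo n (λ r → a r * (x s * g s r)))
    ≡⟨ sumTo-cong m (λ s _ → sumTo-cong n (λ r _ → x∙yz≈y∙xz (a r) (x s) (g s r))) ⟩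
  sumTo m (λ s → sumTo n (λ r → x s * (a r * g s r)))
    ≡⟨ sumTo-cong m (λ s _ → sumTo-distribˡ n (x s) _) ⟨
  sumTo m (λ s → x s * sumTo n (λ r → a r * g s r)) ∎

⊛-identityʳ : ∀ (f : FPS) n → (f ⊛ oneS) n ≡ f n
⊛-identityʳ f zero    = ℤ.*-identityʳ (f 0)
⊛-identityʳ f (suc n) = begin
  sumTo n (λ k → f k * oneS (suc n ∸ k)) + f (suc n) * oneS (n ∸ n)
    ≡⟨ cong₂ _+_ (sumTo-zero n below-n) (cong (λ t → f (suc n) * oneS t) (n∸n≡0 n)) ⟩
  0ℤ + f (suc n) * 1ℤ ≡⟨ ℤ.+-identityˡ _ ⟩
  f (suc n) * 1ℤ      ≡⟨ ℤ.*-identityʳ _ ⟩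
  f (suc n)           ∎
  where
  below-n : ∀ k → k ≤ n → f k * oneS (suc n ∸ k) ≡ 0ℤ
  below-n k k≤n = trans (cong (λ t → f k * oneS t) (+-∸-assoc 1 k≤n)) (ℤ.*-zeroʳ (f k))

-- Riordan arrays from an A-sequence

column : (ℕ → ℕ → ℤ) → ℕ → FPS
column X j i = X i j

module FromASequence (a : FPS) where

  -- The array R(1, h) with A-sequence a.
  H : ℕ → ℕ → ℤ
  H zero    zero    = 1ℤ
  H zero    (suc j) = 0ℤ
  H (suc i) zero    = 0ℤ
  H (suc i) (suc j) = sumTo i (λ r → a r * H i (j ℕ.+ r))

  h : FPS
  h = column H 1

  H-lowerTriangular : ∀ {i j} → i < j → H i j ≡ 0ℤ
  H-lowerTriangular {zero}  {suc j} _ = refl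
  H-lowerTriangular {suc i} {suc j} (s≤s i<j) = sumTo-zero i (λ r _ →
    trans (cong (a r *_) (H-lowerTriangular (<-≤-trans i<j (m≤m+n j r)))) (ℤ.*-zeroʳ (a r)))

  H-column-zero : ∀ n → H n 0 ≡ oneS n
  H-column-zero zero    = refl
  H-column-zero (suc n) = refl

  H-suc-suc : ∀ {n i} k → n ≤ i → sumTo i (λ r → a r * H n (k ℕ.+ r)) ≡ H (suc n) (suc k)
  H-suc-suc {n} {i} k n≤i = sumTo-truncate i _ n≤i (λ r n<r _ →
    trans (cong (a r *_) (H-lowerTriangular (<-≤-trans n<r (m≤n+m r k)))) (ℤ.*-zeroʳ (a r)))

  convolution : (X : ℕ → ℕ → ℤ) → (∀ j → X 0 (suc j) ≡ 0ℤ) → IsASequence X a →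
    ∀ i j k → X i (j ℕ.+ k) ≡ (column X j ⊛ column H k) i
  convolution X row₀ X-A i j zero = begin
    X i (j ℕ.+ 0)          ≡⟨ cong (X i) (+-identityʳ j) ⟩
    X i j                  ≡⟨ ⊛-identityʳ (column X j) i ⟨
    (column X j ⊛ oneS) i  ≡⟨ sumTo-cong i (λ m _ → cong (X m j *_) (H-column-zero (i ∸ m))) ⟨
    (column X j ⊛ column H 0) i ∎
  convolution X row₀ X-A zero j (suc k) = begin
    X 0 (j ℕ.+ suc k)     ≡⟨ cong (X 0) (+-suc j k) ⟩
    X 0 (suc (j ℕ.+ k))   ≡⟨ row₀ (j ℕ.+ k) ⟩
    0ℤ                    ≡⟨ ℤ.*-zeroʳ (X 0 j) ⟨
    X 0 j * H 0 (suc k)   ∎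
  convolution X row₀ X-A (suc i) j (suc k) = begin
    X (suc i) (j ℕ.+ suc k)
      ≡⟨ cong (X (suc i)) (+-suc j k) ⟩
    X (suc i) (suc (j ℕ.+ k))
      ≡⟨ X-A i (j ℕ.+ k) ⟩
    sumTo i (λ r → a r * X i (j ℕ.+ k ℕ.+ r))
      ≡⟨ sumTo-cong i (λ r _ → cong (a r *_) (trans (cong (X i) (+-assoc j k r))
                                                    (convolution X row₀ X-A i j (k ℕ.+ r)))) ⟩
    sumTo i (λ r → a r * sumTo i (λ m → X m j * H (i ∸ m) (k ℕ.+ r)))
      ≡⟨ sumTo-interchange i i a (column X j) (λ m r → H (i ∸ m) (k ℕ.+ r)) ⟩
    sumTo i (λ m → X m j * sumTo i (λ r → a r * H (i ∸ m) (k ℕ.+ r)))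
      ≡⟨ sumTo-cong i (λ m m≤i → cong (X m j *_) (trans (H-suc-suc k (m∸n≤m i m))
                                    (cong (λ t → H t (suc k)) (sym (+-∸-assoc 1 m≤i))))) ⟩
    sumTo i (λ m → X m j * H (suc i ∸ m) (suc k))
      ≡⟨ ℤ.+-identityʳ _ ⟨
    sumTo i (λ m → X m j * H (suc i ∸ m) (suc k)) + 0ℤ
      ≡⟨ cong (λ t → sumTo i (λ m → X m j * H (suc i ∸ m) (suc k)) + t) last-term≡0 ⟨
    (column X j ⊛ column H (suc k)) (suc i) ∎
    where
    last-term≡0 : X (suc i) j * H (i ∸ i) (suc k) ≡ 0ℤ
    last-term≡0 = trans (cong (λ t → X (suc i) j * H t (suc k)) (n∸n≡0 i)) (ℤ.*-zeroʳ (X (suc i) j))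

  H-column-power : ∀ j n → H n j ≡ (h ^S j) n
  H-column-power zero    n = H-column-zero n
  H-column-power (suc j) n = begin
    H n (suc j)                   ≡⟨ cong (H n) (+-comm 1 j) ⟩
    H n (j ℕ.+ 1)                 ≡⟨ convolution H (λ _ → refl) (λ _ _ → refl) n j 1 ⟩
    (column H j ⊛ h) n            ≡⟨ sumTo-cong n (λ m _ → cong (_* h (n ∸ m)) (H-column-power j m)) ⟩
    ((h ^S j) ⊛ h) n              ∎

A-sequence⇒properRiordan : (X : ℕ → ℕ → ℤ) (a : FPS) →
  ¬ X 0 0 ≡ 0ℤ → (∀ j → X 0 (suc j) ≡ 0ℤ) → ¬ a 0 ≡ 0ℤ → IsASequence X a →
  IsProperRiordan X
A-sequence⇒properRiordan X a X₀₀≢0 row₀ a₀≢0 X-A =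
  column X 0 , h , (X₀₀≢0 , refl , h₁≢0) , entries
  where
  open FromASequence a
  h₁≢0 : ¬ h 1 ≡ 0ℤ
  h₁≢0 h₁≡0 = a₀≢0 (trans (sym (ℤ.*-identityʳ (a 0))) h₁≡0)
  entries : ∀ i j → X i j ≡ riordanEntry (column X 0) h i j
  entries i j = trans (convolution X row₀ X-A i 0 j)
                      (sumTo-cong i (λ m _ → cong (X m 0 *_) (H-column-power j (i ∸ m))))

Zseq-toℕ : ∀ ℓ (α : Fin ℓ → ℕ) (k : Fin ℓ) → Zseq ℓ α (toℕ k) ≡ + α k
Zseq-toℕ ℓ α k with toℕ k ℕ.<? ℓ
... | yes k<ℓ = cong (λ x → + α x) (fromℕ<-toℕ k k<ℓ)
... | no  k≮ℓ = contradiction (toℕ<n k) k≮ℓ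

Zseq-ℓ : ∀ ℓ (α : Fin ℓ → ℕ) → Zseq ℓ α ℓ ≡ 1ℤ
Zseq-ℓ ℓ α with ℓ ℕ.<? ℓ
... | yes ℓ<ℓ = contradiction ℓ<ℓ (n≮n ℓ)
... | no  _ with ℓ ℕ.≟ ℓ
...   | yes _  = refl
...   | no ℓ≢ℓ = contradiction refl ℓ≢ℓ

Zseq-> : ∀ ℓ (α : Fin ℓ → ℕ) r → ℓ < r → Zseq ℓ α r ≡ 0ℤ
Zseq-> ℓ α r ℓ<r with r ℕ.<? ℓ
... | yes r<ℓ = contradiction (<-trans ℓ<r r<ℓ) (n≮n ℓ)
... | no  _ with r ℕ.≟ ℓ
...   | yes refl = contradiction ℓ<r (n≮n r)
...   | no  _    = refl

Aseq-suc : ∀ ℓ (β : Fin ℓ → ℕ) r → Aseq ℓ β (suc r) ≡ Zseq ℓ β r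
Aseq-suc ℓ β r with r ℕ.<? ℓ
... | yes _ = refl
... | no  _ with r ℕ.≟ ℓ
...   | yes _ = refl
...   | no  _ = refl

Zseq-sumTo : ∀ ℓ (α : Fin ℓ → ℕ) (v : FPS) {n} → ℓ ≤ n →
  sumTo n (λ r → Zseq ℓ α r * v r) ≡ sumℤ (λ k → + α k * v (toℕ k)) + v ℓ
Zseq-sumTo ℓ α v {n} ℓ≤n = begin
  sumTo n (λ r → Zseq ℓ α r * v r)
    ≡⟨ sumTo-truncate n _ ℓ≤n (λ r ℓ<r _ → cong (_* v r) (Zseq-> ℓ α r ℓ<r)) ⟩
  sumTo ℓ (λ r → Zseq ℓ α r * v r)
    ≡⟨ sumTo-toℕ ℓ _ ⟩
  sumℤ {ℓ} (λ k → Zseq ℓ α (toℕ k) * v (toℕ k)) + Zseq ℓ α ℓ * v ℓ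
    ≡⟨ cong₂ _+_ (sum-cong-≗ (λ k → cong (_* v (toℕ k)) (Zseq-toℕ ℓ α k))) (trans (cong (_* v ℓ) (Zseq-ℓ ℓ α)) (ℤ.*-identityˡ (v ℓ))) ⟩
  sumℤ (λ k → + α k * v (toℕ k)) + v ℓ ∎

Aseq-sumTo : ∀ ℓ (β : Fin ℓ → ℕ) (v : FPS) {n} → suc ℓ ≤ n →
  sumTo n (λ r → Aseq ℓ β r * v r) ≡ v 0 + (sumℤ (λ k → + β k * v (suc (toℕ k))) + v (suc ℓ))
Aseq-sumTo ℓ β v {suc n} (s≤s ℓ≤n) = begin
  sumTo (suc n) (λ r → Aseq ℓ β r * v r)
    ≡⟨ sumTo-suc n _ ⟩
  1ℤ * v 0 + sumTo n (λ r → Aseq ℓ β (suc r) * v (suc r))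
    ≡⟨ cong₂ _+_ (ℤ.*-identityˡ (v 0)) (sumTo-cong n (λ r _ → cong (_* v (suc r)) (Aseq-suc ℓ β r))) ⟩
  v 0 + sumTo n (λ r → Zseq ℓ β r * v (suc r))
    ≡⟨ cong (λ t → v 0 + t) (Zseq-sumTo ℓ β (λ r → v (suc r)) ℓ≤n) ⟩
  v 0 + (sumℤ (λ k → + β k * v (suc (toℕ k))) + v (suc ℓ)) ∎

-- Counting colored Motzkin paths by their last step

module _ {ℓ : ℕ} {α β : Fin ℓ → ℕ} where

  height≤length : ∀ {n m} → Path ℓ α β n m → m ≤ n
  height≤length nil                 = z≤n
  height≤length (up p)              = s≤s (height≤length p)
  height≤length (down {h = h} i p _) = m≤n⇒m≤1+n (m+n≤o⇒m≤o h (height≤length p))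
  height≤length (downℓ {h = h} p)    = m≤n⇒m≤1+n (m+n≤o⇒m≤o h (height≤length p))

  LastDown : ℕ → ℕ → Set
  LastDown n h = Σ (Fin ℓ) λ i → Fin (colors α β i h) × Path ℓ α β n (h ℕ.+ toℕ i)

  Path-suc-suc↔ : ∀ {n h} → Path ℓ α β (suc n) (suc h)
    ↔ (Path ℓ α β n h ⊎ (LastDown n (suc h) ⊎ Path ℓ α β n (suc h ℕ.+ ℓ)))
  Path-suc-suc↔ {n} {h} = mk↔ₛ′ split join
      (λ { (inj₁ _) → refl ; (inj₂ (inj₁ _)) → refl ; (inj₂ (inj₂ _)) → refl })
      (λ { (up _) → refl ; (down _ _ _) → refl ; (downℓ _) → refl })
    where
    split : Path ℓ α β (suc n) (suc h) → Path ℓ α β n h ⊎ (LastDown n (suc h) ⊎ Path ℓ α β n (suc h ℕ.+ ℓ))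
    split (up p)       = inj₁ p
    split (down i p c) = inj₂ (inj₁ (i , c , p))
    split (downℓ p)    = inj₂ (inj₂ p)
    join : Path ℓ α β n h ⊎ (LastDown n (suc h) ⊎ Path ℓ α β n (suc h ℕ.+ ℓ)) → Path ℓ α β (suc n) (suc h)
    join (inj₁ p)                 = up p
    join (inj₂ (inj₁ (i , c , p))) = down i p c
    join (inj₂ (inj₂ p))          = downℓ p

  Path-suc-zero↔ : ∀ {n} → Path ℓ α β (suc n) 0 ↔ (LastDown n 0 ⊎ Path ℓ α β n ℓ)
  Path-suc-zero↔ {n} = mk↔ₛ′ split join
      (λ { (inj₁ _) → refl ; (inj₂ _) → refl })
      (λ { (down _ _ _) → refl ; (downℓ _) → refl })
    where
    split : Path ℓ α β (suc n) 0 → LastDown n 0 ⊎ Path ℓ α β n ℓ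
    split (down i p c) = inj₁ (i , c , p)
    split (downℓ p)    = inj₂ p
    join : LastDown n 0 ⊎ Path ℓ α β n ℓ → Path ℓ α β (suc n) 0
    join (inj₁ (i , c , p)) = down i p c
    join (inj₂ p)           = downℓ p

Σ-Fin↔ : ∀ {k} (P : Fin k → Set) (f : Fin k → ℕ) → (∀ i → P i ↔ Fin (f i)) →
  Σ (Fin k) P ↔ Fin (sumℕ f)
Σ-Fin↔ {zero}  P f P≅ = mk↔ₛ′ (λ ()) (λ ()) (λ ()) (λ ())
Σ-Fin↔ {suc k} P f P≅ =
  ↔-sym +↔⊎ ↔-∘ ((P≅ Fin.zero ⊎-↔ Σ-Fin↔ (λ i → P (Fin.suc i)) (λ i → f (Fin.suc i)) (λ i → P≅ (Fin.suc i)))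
                 ↔-∘ split↔)
  where
  split↔ : Σ (Fin (suc k)) P ↔ (P Fin.zero ⊎ Σ (Fin k) (λ i → P (Fin.suc i)))
  split↔ = mk↔ₛ′
    (λ { (Fin.zero , p) → inj₁ p ; (Fin.suc i , p) → inj₂ (i , p) })
    (λ { (inj₁ p) → Fin.zero , p ; (inj₂ (i , p)) → Fin.suc i , p })
    (λ { (inj₁ _) → refl ; (inj₂ _) → refl })
    (λ { (Fin.zero , _) → refl ; (Fin.suc _ , _) → refl })

module Counting {ℓ : ℕ} {α β : Fin ℓ → ℕ} (M : ℕ → ℕ → ℕ)
                (paths≅ : ∀ n m → Path ℓ α β n m ↔ Fin (M n m)) where

  LastDown↔ : ∀ n h → LastDown {ℓ} {α} {β} n h ↔ Fin (sumℕ (λ i → colors α β i h ℕ.* M n (h ℕ.+ toℕ i)))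
  LastDown↔ n h = Σ-Fin↔ _ _ (λ i → ↔-sym *↔× ↔-∘ (↔-id _ ×-↔ paths≅ n (h ℕ.+ toℕ i)))

  M-0-0 : M 0 0 ≡ 1
  M-0-0 = ↔⇒≡ (single ↔-∘ ↔-sym (paths≅ 0 0))
    where
    single : Path ℓ α β 0 0 ↔ Fin 1
    single = mk↔ₛ′ (λ _ → Fin.zero) (λ _ → nil) (λ { Fin.zero → refl ; (Fin.suc ()) }) (λ { nil → refl })

  M-0-suc : ∀ j → M 0 (suc j) ≡ 0
  M-0-suc j = ↔⇒≡ (mk↔ₛ′ (λ ()) (λ ()) (λ ()) (λ ()) ↔-∘ ↔-sym (paths≅ 0 (suc j)))

  M-lowerTriangular : ∀ {n m} → n < m → M n m ≡ 0
  M-lowerTriangular {n} {m} n<m with M n m | paths≅ n m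
  ... | zero  | _     = refl
  ... | suc _ | paths = contradiction (height≤length (Inverse.from paths Fin.zero)) (<⇒≱ n<m)

  M-suc-zero : ∀ n → M (suc n) 0 ≡ sumℕ (λ i → α i ℕ.* M n (toℕ i)) ℕ.+ M n ℓ
  M-suc-zero n = ↔⇒≡ (↔-sym +↔⊎ ↔-∘ ((LastDown↔ n 0 ⊎-↔ paths≅ n ℓ)
                                   ↔-∘ (Path-suc-zero↔ ↔-∘ ↔-sym (paths≅ (suc n) 0))))

  M-suc-suc : ∀ n h → M (suc n) (suc h)
    ≡ M n h ℕ.+ (sumℕ (λ i → β i ℕ.* M n (suc h ℕ.+ toℕ i)) ℕ.+ M n (suc h ℕ.+ ℓ))
  M-suc-suc n h = ↔⇒≡ (↔-sym +↔⊎ ↔-∘ ((paths≅ n h ⊎-↔ (↔-sym +↔⊎ ↔-∘ (LastDown↔ n (suc h) ⊎-↔ paths≅ n (suc h ℕ.+ ℓ))))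
                                   ↔-∘ (Path-suc-suc↔ ↔-∘ ↔-sym (paths≅ (suc n) (suc h)))))

  Mℤ : ℕ → ℕ → ℤ
  Mℤ n m = + M n m

  Mℤ-suc-zero : ∀ n → Mℤ (suc n) 0 ≡ sumℤ (λ k → + α k * Mℤ n (toℕ k)) + Mℤ n ℓ
  Mℤ-suc-zero n = begin
    + M (suc n) 0                                      ≡⟨ cong +_ (M-suc-zero n) ⟩
    + (sumℕ (λ k → α k ℕ.* M n (toℕ k)) ℕ.+ M n ℓ)     ≡⟨ ℤ.pos-+ _ (M n ℓ) ⟩
    + sumℕ (λ k → α k ℕ.* M n (toℕ k)) + Mℤ n ℓ        ≡⟨ cong (_+ Mℤ n ℓ) (pos-sumℕ _ _ (λ k → ℤ.pos-* (α k) _)) ⟩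
    sumℤ (λ k → + α k * Mℤ n (toℕ k)) + Mℤ n ℓ         ∎

  Mℤ-suc-suc : ∀ n h → Mℤ (suc n) (suc h)
    ≡ Mℤ n h + (sumℤ (λ k → + β k * Mℤ n (suc h ℕ.+ toℕ k)) + Mℤ n (suc h ℕ.+ ℓ))
  Mℤ-suc-suc n h = begin
    + M (suc n) (suc h)
      ≡⟨ cong +_ (M-suc-suc n h) ⟩
    + (M n h ℕ.+ (sumℕ (λ k → β k ℕ.* M n (suc h ℕ.+ toℕ k)) ℕ.+ M n (suc h ℕ.+ ℓ)))
      ≡⟨ ℤ.pos-+ (M n h) _ ⟩
    Mℤ n h + + (sumℕ (λ k → β k ℕ.* M n (suc h ℕ.+ toℕ k)) ℕ.+ M n (suc h ℕ.+ ℓ))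
      ≡⟨ cong (λ t → Mℤ n h + t) (ℤ.pos-+ _ (M n (suc h ℕ.+ ℓ))) ⟩
    Mℤ n h + (+ sumℕ (λ k → β k ℕ.* M n (suc h ℕ.+ toℕ k)) + Mℤ n (suc h ℕ.+ ℓ))
      ≡⟨ cong (λ t → Mℤ n h + (t + Mℤ n (suc h ℕ.+ ℓ))) (pos-sumℕ _ _ (λ k → ℤ.pos-* (β k) _)) ⟩
    Mℤ n h + (sumℤ (λ k → + β k * Mℤ n (suc h ℕ.+ toℕ k)) + Mℤ n (suc h ℕ.+ ℓ)) ∎

  row-sumTo-truncate : ∀ i j {m} (c : FPS) → i ≤ m →
    sumTo m (λ r → c r * Mℤ i (j ℕ.+ r)) ≡ sumTo i (λ r → c r * Mℤ i (j ℕ.+ r))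
  row-sumTo-truncate i j {m} c i≤m = sumTo-truncate m _ i≤m (λ r i<r _ →
    trans (cong (λ t → c r * + t) (M-lowerTriangular (<-≤-trans i<r (m≤n+m r j)))) (ℤ.*-zeroʳ (c r)))

  Z-sequence : IsZSequence Mℤ (Zseq ℓ α)
  Z-sequence i = begin
    Mℤ (suc i) 0                                 ≡⟨ Mℤ-suc-zero i ⟩
    sumℤ (λ k → + α k * Mℤ i (toℕ k)) + Mℤ i ℓ   ≡⟨ Zseq-sumTo ℓ α (Mℤ i) (m≤n+m ℓ i) ⟨
    sumTo (i ℕ.+ ℓ) (λ r → Zseq ℓ α r * Mℤ i r)  ≡⟨ row-sumTo-truncate i 0 (Zseq ℓ α) (m≤m+n i ℓ) ⟩
    sumTo i (λ r → Zseq ℓ α r * Mℤ i r)          ∎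

  A-sequence : IsASequence Mℤ (Aseq ℓ β)
  A-sequence i j = begin
    Mℤ (suc i) (suc j)
      ≡⟨ Mℤ-suc-suc i j ⟩
    Mℤ i j + (sumℤ (λ k → + β k * Mℤ i (suc j ℕ.+ toℕ k)) + Mℤ i (suc j ℕ.+ ℓ))
      ≡⟨ cong₂ (λ x y → Mℤ i x + y) (+-identityʳ j) (cong₂ _+_
           (sum-cong-≗ (λ k → cong (λ t → + β k * Mℤ i t) (+-suc j (toℕ k))))
           (cong (Mℤ i) (+-suc j ℓ))) ⟨
    v 0 + (sumℤ (λ k → + β k * v (suc (toℕ k))) + v (suc ℓ))
      ≡⟨ Aseq-sumTo ℓ β v (m≤n+m (suc ℓ) i) ⟨
    sumTo (i ℕ.+ suc ℓ) (λ r → Aseq ℓ β r * v r)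
      ≡⟨ row-sumTo-truncate i j (Aseq ℓ β) (m≤m+n i (suc ℓ)) ⟩
    sumTo i (λ r → Aseq ℓ β r * v r) ∎
    where
    v : FPS
    v r = Mℤ i (j ℕ.+ r)

proposition2p1 : (ℓ : ℕ) → 1 ≤ ℓ → (α β : Fin ℓ → ℕ)
    → (M : ℕ → ℕ → ℕ)
    → ((n m : ℕ) → Path ℓ α β n m ↔ Fin (M n m))
    → IsProperRiordan (λ n m → + M n m)
    × IsASequence (λ n m → + M n m) (Aseq ℓ β)
    × IsZSequence (λ n m → + M n m) (Zseq ℓ α)
proposition2p1 ℓ _ α β M paths≅ =
  A-sequence⇒properRiordan Mℤ (Aseq ℓ β) M₀₀≢0 (λ j → cong +_ (M-0-suc j)) (λ ()) A-sequence ,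
  A-sequence ,
  Z-sequence
  where
  open Counting M paths≅
  M₀₀≢0 : ¬ Mℤ 0 0 ≡ 0ℤ
  M₀₀≢0 M₀₀≡0 with trans (cong +_ (sym M-0-0)) M₀₀≡0
  ... | ()
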